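{- Let $T$ be a tree of order $n$ with $\operatorname{diam}(T)\geq 3$ such that $\gamma_{t,coi}(T)=n-|L(T)|$. If $S^\ast(T)\neq\emptyset$, then $SS(T)\subseteq N(S^\ast(T))$.
   Context: All graphs are finite, simple and undirected. For a graph $G$, a set $D\subseteq V(G)$ is a total dominating set if every vertex of $G$ has at least one neighbor in $D$. A total dominating set $D$ is a total co-independent dominating set if $V(G)\setminus D$ is nonempty and independent. $\gamma_{t,coi}(G)$ is the minimum cardinality of a total co-independent dominating set of $G$. For a tree $T$: a leaf is a vertex of degree one and $L(T)$ is the set of leaves; a support vertex is a non-leaf vertex adjacent to a leaf, and $S(T)$ is the set of support vertices; a semi-support vertex is a vertex that is neither a leaf nor a support vertex and is adjacent to a support vertex, and $SS(T)$ is the set of semi-support vertices; an isolated support vertex is a support vertex having no neighbor in $S(T)$, and $S^\ast(T)$ is the set of isolated support vertices. For $X\subseteq V(T)$, $N(X)$ is the union of the open neighborhoods of the vertices of $X$. -}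

module Defs where

open import Data.Nat using (ℕ; zero; suc; _≤_; _≡ᵇ_)
open import Data.Bool using (Bool; true; false; T)
open import Data.Fin using (Fin)
open import Data.Fin.Subset using (Subset; _∈_; _∉_; _⊆_; ∣_∣)
open import Data.Vec using (tabulate)
open import Data.List using (List; []; _∷_; _++_; length)
open import Data.List.Relation.Unary.Unique.Propositional using (Unique)
open import Data.Product using (Σ; ∃; ∃-syntax; _×_; _,_)
open import Relation.Nullary using (¬_)
open import Data.Unit using (⊤)
open import Relation.Binary.PropositionalEquality using (_≡_)

record Graph (n : ℕ) : Set where
  field
    adj   : Fin n → Fin n → Bool
    sym   : ∀ u v → adj u v ≡ adj v u
    irrfl : ∀ v → adj v v ≡ false

module _ {n : ℕ} (G : Graph n) where
  open Graph G

  E : Fin n → Fin n → Set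
  E u v = adj u v ≡ true

  data Walk : Fin n → Fin n → ℕ → Set where
    here : ∀ {v} → Walk v v zero
    step : ∀ {u w v k} → E u w → Walk w v k → Walk u v (suc k)

  Connected : Set
  Connected = ∀ u v → ∃[ k ] Walk u v k

  IsPath : List (Fin n) → Set
  IsPath [] = ⊤
  IsPath (x ∷ []) = ⊤
  IsPath (x ∷ y ∷ r) = E x y × IsPath (y ∷ r)

  HasCycle : Set
  HasCycle = Σ (Fin n) λ h → Σ (List (Fin n)) λ r →
    (2 ≤ length r) × Unique (h ∷ r) × IsPath (h ∷ r ++ h ∷ [])

  IsTree : Set
  IsTree = Connected × ¬ HasCycle

  DiamAtLeast3 : Set
  DiamAtLeast3 = ∃[ u ] ∃[ v ] (∀ k → Walk u v k → ¬ (k ≤ 2))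

  Nbhd : Fin n → Subset n
  Nbhd v = tabulate (adj v)

  deg : Fin n → ℕ
  deg v = ∣ Nbhd v ∣

  IsLeaf : Fin n → Set
  IsLeaf v = deg v ≡ 1

  Leaves : Subset n
  Leaves = tabulate (λ v → deg v ≡ᵇ 1)

  IsSupport : Fin n → Set
  IsSupport v = ¬ IsLeaf v × ∃[ u ] (E v u × IsLeaf u)

  IsSemiSupport : Fin n → Set
  IsSemiSupport v = ¬ IsLeaf v × ¬ IsSupport v × ∃[ u ] (E v u × IsSupport u)

  IsIsolatedSupport : Fin n → Set
  IsIsolatedSupport v = IsSupport v × (∀ u → E v u → ¬ IsSupport u)

  InNbhdOf : (Fin n → Set) → Fin n → Set
  InNbhdOf X v = ∃[ x ] (X x × E x v)

  IsTotalDominating : Subset n → Set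
  IsTotalDominating D = ∀ v → ∃[ u ] (u ∈ D × E v u)

  IsTCoIDS : Subset n → Set
  IsTCoIDS D = IsTotalDominating D
             × (∃[ v ] v ∉ D)
             × (∀ u v → u ∉ D → v ∉ D → ¬ E u v)

  γtcoi≡ : ℕ → Set
  γtcoi≡ k = (∃[ D ] (IsTCoIDS D × ∣ D ∣ ≡ k))
           × (∀ D → IsTCoIDS D → k ≤ ∣ D ∣)

module Submission where

-- Let v be a semi-support vertex of a tree T with
-- γ_{t,coi}(T) = n − |L(T)|, and consider the set D_v = V(T) ∖ (L(T) ∪ {v})
-- of size n − |L(T)| − 1.  Its complement L(T) ∪ {v} is independent (no two
-- leaves are adjacent in a connected graph with a non-leaf vertex, and v is
-- not a support vertex), so by minimality D_v cannot be total dominating.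
-- Every leaf and v itself are dominated by D_v, hence some non-leaf w ≠ v has
-- no non-leaf neighbour other than v: a "blocker" for v.  By connectivity a
-- blocker is adjacent to v, and then it is an isolated support vertex: its
-- other neighbours are leaves, and v is not a support vertex.

open import Defs
open import Data.Nat using (ℕ; _∸_; _<_; _≟_; _≡ᵇ_)
open import Data.Nat.Properties using (≡ᵇ⇒≡; <⇒≱; ≤-reflexive)
open import Data.Fin using (Fin; zero; suc) renaming (_≟_ to _≟ᶠ_)
open import Data.Fin.Properties using (any?)
open import Data.Fin.Subset using (Subset; ∣_∣; _∈_; _∉_; ⁅_⁆; ∁; _-_; inside; outside; _⊂_)
open import Data.Fin.Subset.Properties
  using (x∈⁅y⁆⇒x≡y; x≢y⇒x∉⁅y⁆; x∈⁅x⁆; ⊆-antisym; ∣⁅x⁆∣≡1; p⊂q⇒∣p∣<∣q∣; x∈p⇒∣p-x∣<∣p∣;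
         x∉p⇒x∈∁p; x∈p∧x≢y⇒x∈p-y; ∣∁p∣≡n∸∣p∣)
open import Data.Vec using (_∷_; tabulate)
open import Data.Vec.Properties using (lookup∘tabulate; []=⇒lookup; lookup⇒[]=)
open import Data.Vec.Base using (there)
open import Data.Bool using (true; T) renaming (_≟_ to _≟ᵇ_)
open import Data.Product using (∃-syntax; _×_; _,_; proj₁; proj₂)
open import Data.Sum using (_⊎_; inj₁; inj₂)
open import Data.Empty using (⊥-elim)
open import Relation.Nullary using (¬_; Dec; yes; no)
open import Relation.Nullary.Decidable using (_×-dec_; ¬?; decidable-stable)
open import Relation.Binary.PropositionalEquality using (_≡_; refl; sym; trans; cong; subst; _≢_)
open import Function using (_∘_)

x∉p-x : ∀ {n} (p : Subset n) (x : Fin n) → x ∉ p - x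
x∉p-x (inside ∷ p)  zero    ()
x∉p-x (outside ∷ p) zero    ()
x∉p-x (_ ∷ p)       (suc x) (there h) = x∉p-x p x h

module _ {n : ℕ} (G : Graph n) where
  open Graph G using (adj; irrfl)

  ∈Nbhd⇒E : ∀ w x → x ∈ Nbhd G w → E G w x
  ∈Nbhd⇒E w x h = trans (sym (lookup∘tabulate (adj w) x)) ([]=⇒lookup h)

  E⇒∈Nbhd : ∀ w x → E G w x → x ∈ Nbhd G w
  E⇒∈Nbhd w x e = lookup⇒[]= x _ (trans (lookup∘tabulate (adj w) x) e)

  ∈Leaves⇒leaf : ∀ x → x ∈ Leaves G → IsLeaf G x
  ∈Leaves⇒leaf x h = ≡ᵇ⇒≡ (deg G x) 1 (subst T
    (sym (trans (sym (lookup∘tabulate (λ v → deg G v ≡ᵇ 1) x)) ([]=⇒lookup h))) _)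

  E? : ∀ u v → Dec (E G u v)
  E? u v = adj u v ≟ᵇ true

  leaf? : ∀ v → Dec (IsLeaf G v)
  leaf? v = deg G v ≟ 1

  E-sym : ∀ {u v} → E G u v → E G v u
  E-sym {u} {v} e = trans (sym (Graph.sym G u v)) e

  E⇒≢ : ∀ {u v} → E G u v → u ≢ v
  E⇒≢ {u} e refl with trans (sym e) (irrfl u)
  ... | ()

  sole-neighbour⇒leaf : ∀ w y → E G w y → (∀ z → E G w z → z ≡ y) → IsLeaf G w
  sole-neighbour⇒leaf w y e only = trans (cong ∣_∣ Nw≡⁅y⁆) (∣⁅x⁆∣≡1 y)
    where
    Nw≡⁅y⁆ : Nbhd G w ≡ ⁅ y ⁆
    Nw≡⁅y⁆ = ⊆-antisym
      (λ {z} h → subst (_∈ ⁅ y ⁆) (sym (only z (∈Nbhd⇒E w z h))) (x∈⁅x⁆ y))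
      (λ {z} h → subst (_∈ Nbhd G w) (sym (x∈⁅y⁆⇒x≡y y h)) (E⇒∈Nbhd w y e))

  leaf-neighbour-unique : ∀ y a b → IsLeaf G y → E G y a → E G y b → a ≡ b
  leaf-neighbour-unique y a b l ea eb with a ≟ᶠ b
  ... | yes a≡b = a≡b
  ... | no a≢b  = ⊥-elim (<⇒≱ (p⊂q⇒∣p∣<∣q∣ ⁅a⁆⊂Ny) (≤-reflexive (trans l (sym (∣⁅x⁆∣≡1 a)))))
    where
    ⁅a⁆⊂Ny : ⁅ a ⁆ ⊂ Nbhd G y
    ⁅a⁆⊂Ny = (λ {z} h → subst (_∈ Nbhd G y) (sym (x∈⁅y⁆⇒x≡y a h)) (E⇒∈Nbhd y a ea))
           , b , E⇒∈Nbhd y b eb , x≢y⇒x∉⁅y⁆ (a≢b ∘ sym)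

  closed⇒everything : Connected G → (C : Fin n → Set)
                    → (∀ a b → C a → E G a b → C b) → ∀ {a} → C a → ∀ b → C b
  closed⇒everything conn C closed {a} ca b = follow ca (proj₂ (conn a b))
    where
    follow : ∀ {x y k} → C x → Walk G x y k → C y
    follow cx here       = cx
    follow cx (step e w) = follow (closed _ _ cx e) w

  -- In a connected graph with a non-leaf vertex v, no two leaves are
  -- adjacent (otherwise they would form a whole component).
  no-adjacent-leaves : Connected G → ∀ v → ¬ IsLeaf G v
                     → ∀ w x → IsLeaf G w → E G w x → ¬ IsLeaf G x
  no-adjacent-leaves conn v v-inner w x lw e lx =
    v-outside (closed⇒everything conn C closed (inj₁ refl) v)
    where
    C : Fin n → Set
    C z = z ≡ w ⊎ z ≡ x
    closed : ∀ a b → C a → E G a b → C b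
    closed a b (inj₁ refl) eab = inj₂ (leaf-neighbour-unique w b x lw eab e)
    closed a b (inj₂ refl) eab = inj₁ (leaf-neighbour-unique x b w lx eab (E-sym e))
    v-outside : ¬ C v
    v-outside (inj₁ refl) = v-inner lw
    v-outside (inj₂ refl) = v-inner lx

  InnerNeighbourBesides : Fin n → Fin n → Set
  InnerNeighbourBesides v w = ∃[ y ] (E G w y × ¬ IsLeaf G y × y ≢ v)

  -- A blocker for v: a non-leaf w ≠ v all of whose non-leaf neighbours are v.
  -- A blocker has no neighbour in the candidate set D_v defined below.
  Blocker : Fin n → Fin n → Set
  Blocker v w = ¬ IsLeaf G w × w ≢ v × ¬ InnerNeighbourBesides v w

  inner-neighbour? : ∀ v w → Dec (InnerNeighbourBesides v w)
  inner-neighbour? v w = any? (λ y → E? w y ×-dec ¬? (leaf? y) ×-dec ¬? (y ≟ᶠ v))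

  blocker? : ∀ v w → Dec (Blocker v w)
  blocker? v w = ¬? (leaf? w) ×-dec ¬? (w ≟ᶠ v) ×-dec ¬? (inner-neighbour? v w)

  blocker-neighbour-leaf : ∀ {v w} → Blocker v w → ∀ z → E G w z → z ≢ v → IsLeaf G z
  blocker-neighbour-leaf (_ , _ , none) z e z≢v =
    decidable-stable (leaf? z) (λ z-inner → none (z , e , z-inner , z≢v))

  -- In a connected graph a blocker for v is adjacent to v: otherwise w
  -- together with its (leaf) neighbours would be a whole component.
  blocker-adjacent : Connected G → ∀ {v w} → Blocker v w → E G w v
  blocker-adjacent conn {v} {w} blk@(_ , w≢v , _) =
    decidable-stable (E? w v) λ w≁v →
      v-outside w≁v (closed⇒everything conn C (closed w≁v) (inj₁ refl) v)
    where
    C : Fin n → Set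
    C z = z ≡ w ⊎ E G w z
    closed : ¬ E G w v → ∀ a b → C a → E G a b → C b
    closed _   a b (inj₁ refl) eab = inj₂ eab
    closed w≁v a b (inj₂ ewa)  eab = inj₁ (leaf-neighbour-unique a b w
      (blocker-neighbour-leaf blk a ewa (λ { refl → w≁v ewa })) eab (E-sym ewa))
    v-outside : ¬ E G w v → ¬ C v
    v-outside _   (inj₁ refl) = w≢v refl
    v-outside w≁v (inj₂ e)    = w≁v e

  blocker⇒isolated-support-neighbour : Connected G → ∀ {v w} → ¬ IsSupport G v
    → Blocker v w → InNbhdOf G (IsIsolatedSupport G) v
  blocker⇒isolated-support-neighbour conn {v} {w} v-ns blk@(w-inner , _ , _) =
    w , ((w-inner , z , ewz , blocker-neighbour-leaf blk z ewz z≢v) , isolated) , ewv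
    where
    ewv : E G w v
    ewv = blocker-adjacent conn blk
    other : ∃[ z ] (E G w z × z ≢ v)
    other = decidable-stable (any? (λ z → E? w z ×-dec ¬? (z ≟ᶠ v))) λ none →
      w-inner (sole-neighbour⇒leaf w v ewv λ z e →
        decidable-stable (z ≟ᶠ v) (λ z≢v → none (z , e , z≢v)))
    z = proj₁ other
    ewz = proj₁ (proj₂ other)
    z≢v = proj₂ (proj₂ other)
    isolated : ∀ u → E G w u → ¬ IsSupport G u
    isolated u e u-s with u ≟ᶠ v
    ... | yes refl = v-ns u-s
    ... | no u≢v   = proj₁ u-s (blocker-neighbour-leaf blk u e u≢v)

  candidate : Fin n → Subset n
  candidate v = ∁ (Leaves G) - v

  ∈candidate : ∀ {v x} → ¬ IsLeaf G x → x ≢ v → x ∈ candidate v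
  ∈candidate {x = x} x-inner x≢v =
    x∈p∧x≢y⇒x∈p-y (x∉p⇒x∈∁p (x-inner ∘ ∈Leaves⇒leaf x)) x≢v

  ∉candidate : ∀ {v x} → x ∉ candidate v → IsLeaf G x ⊎ x ≡ v
  ∉candidate {v} {x} x∉ with x ≟ᶠ v | leaf? x
  ... | yes x≡v | _          = inj₂ x≡v
  ... | no _    | yes l      = inj₁ l
  ... | no x≢v  | no x-inner = ⊥-elim (x∉ (∈candidate x-inner x≢v))

  candidate-smaller : ∀ {v} → ¬ IsLeaf G v → ∣ candidate v ∣ < n ∸ ∣ Leaves G ∣
  candidate-smaller {v} v-inner = subst (∣ candidate v ∣ <_) (∣∁p∣≡n∸∣p∣ (Leaves G))
    (x∈p⇒∣p-x∣<∣p∣ (x∉p⇒x∈∁p (v-inner ∘ ∈Leaves⇒leaf v)))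

  candidate-TCoIDS : Connected G → (∀ w → ∃[ y ] E G w y)
    → ∀ {v u} → ¬ IsLeaf G v → ¬ IsSupport G v → E G v u → ¬ IsLeaf G u
    → (∀ w → ¬ Blocker v w) → IsTCoIDS G (candidate v)
  candidate-TCoIDS conn no-isolated {v} {u} v-inner v-ns evu u-inner unblocked =
    dominating , (v , x∉p-x _ v) , independent
    where
    no-leaf-next-to-v : ∀ w → IsLeaf G w → ¬ E G v w
    no-leaf-next-to-v w l e = v-ns (v-inner , w , e , l)
    dominating : IsTotalDominating G (candidate v)
    dominating w with leaf? w | w ≟ᶠ v
    ... | yes lw | _ =
      let (x , ewx) = no-isolated w in
      x , ∈candidate (no-adjacent-leaves conn v v-inner w x lw ewx)
                     (λ { refl → no-leaf-next-to-v w lw (E-sym ewx) }) , ewx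
    ... | no _ | yes refl = u , ∈candidate u-inner (E⇒≢ evu ∘ sym) , evu
    ... | no w-inner | no w≢v =
      let (y , ewy , y-inner , y≢v) = decidable-stable (inner-neighbour? v w)
                                        (λ none → unblocked w (w-inner , w≢v , none)) in
      y , ∈candidate y-inner y≢v , ewy
    independent : ∀ a b → a ∉ candidate v → b ∉ candidate v → ¬ E G a b
    independent a b a∉ b∉ e with ∉candidate a∉ | ∉candidate b∉
    ... | inj₁ la   | inj₁ lb   = no-adjacent-leaves conn v v-inner a b la e lb
    ... | inj₁ la   | inj₂ refl = no-leaf-next-to-v a la (E-sym e)
    ... | inj₂ refl | inj₁ lb   = no-leaf-next-to-v b lb e
    ... | inj₂ refl | inj₂ refl = E⇒≢ e refl

lemma7 : (n : ℕ) (T : Graph n) → IsTree T → DiamAtLeast3 T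
         → γtcoi≡ T (n ∸ ∣ Leaves T ∣)
         → (∃[ s ] IsIsolatedSupport T s)
         → ∀ v → IsSemiSupport T v → InNbhdOf T (IsIsolatedSupport T) v
lemma7 n T (conn , _) _ ((_ , (dom , _) , _) , minimal) _ v (v-inner , v-ns , u , evu , u-s)
  with any? (blocker? T v)
... | yes (w , b) = blocker⇒isolated-support-neighbour T conn v-ns b
... | no unblocked = ⊥-elim (<⇒≱ (candidate-smaller T v-inner) (minimal _ D-TCoIDS))
  where
  no-isolated : ∀ w → ∃[ y ] E T w y
  no-isolated w = let (y , _ , e) = dom w in y , e
  D-TCoIDS : IsTCoIDS T (candidate T v)
  D-TCoIDS = candidate-TCoIDS T conn no-isolated v-inner v-ns evu (proj₁ u-s)
               (λ w b → unblocked (w , b))
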